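{- Let $q\ge0$ and $n\ge0$ be integers. The number of $q$-blooming trees on $n+1$ nodes is $\dfrac{(2n+q-1)!!}{(q-1)!!}$.
   Context: An increasing ordered tree on $n+1$ nodes is a rooted tree with nodes labeled $0,1,\dots,n$ such that labels increase along every path from the root, together with a total order on the children of each node. A $q$-blooming tree on $n+1$ nodes is an increasing ordered tree on $n+1$ nodes with $q$ additional indistinguishable unlabeled leaves ("blooms") attached as children of the root; two $q$-blooming trees are equal iff the underlying increasing ordered trees coincide and the blooms occupy the same positions in the total order of the children of the root. Convention: $(-1)!!=1$. -}

module Defs where

open import Data.Nat using (ℕ; zero; suc; _+_; _*_; _<_)
open import Data.List using (List; []; _∷_; _++_; map; upTo; length)
open import Data.List.Membership.Propositional using (_∈_)
open import Data.List.Relation.Unary.Unique.Propositional using (Unique)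
open import Data.List.Relation.Binary.Permutation.Propositional using (_↭_)
open import Data.Maybe using (Maybe; just; nothing)
open import Data.Product using (Σ; _×_)
open import Data.Unit using (⊤)
open import Function.Bundles using (_⇔_)

data Tree : Set where
  node : ℕ → List Tree → Tree

mutual
  labels : Tree → List ℕ
  labels (node a ts) = a ∷ labelsL ts

  labelsL : List Tree → List ℕ
  labelsL []       = []
  labelsL (t ∷ ts) = labels t ++ labelsL ts

mutual
  -- labels strictly increase from parent to child (hence along every path)
  Increasing : Tree → Set
  Increasing (node a ts) = ChildrenAbove a ts

  ChildrenAbove : ℕ → List Tree → Set
  ChildrenAbove a []              = ⊤
  ChildrenAbove a (node b us ∷ ts) = (a < b) × ChildrenAbove b us × ChildrenAbove a ts

-- A raw q-blooming tree: the root (label 0) is implicit; its ordered list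
-- of children is given, where 'nothing' is a bloom (unlabeled leaf) and
-- 'just t' is a labeled subtree.
RawBlooming : Set
RawBlooming = List (Maybe Tree)

countBlooms : RawBlooming → ℕ
countBlooms []             = 0
countBlooms (nothing ∷ cs) = suc (countBlooms cs)
countBlooms (just _ ∷ cs)  = countBlooms cs

subtrees : RawBlooming → List Tree
subtrees []             = []
subtrees (nothing ∷ cs) = subtrees cs
subtrees (just t ∷ cs)  = t ∷ subtrees cs

IsBlooming : ℕ → ℕ → RawBlooming → Set
IsBlooming q n c =
  (countBlooms c ≡′ q) × (labelsL (subtrees c) ↭ map suc (upTo n)) × ChildrenAbove 0 (subtrees c)
  where open import Relation.Binary.PropositionalEquality renaming (_≡_ to _≡′_)

HasCardinality : {A : Set} → (A → Set) → ℕ → Set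
HasCardinality {A} P N =
  Σ (List A) (λ xs → Unique xs × ((x : A) → (P x ⇔ (x ∈ xs))) × (length xs ≡′ N))
  where open import Relation.Binary.PropositionalEquality renaming (_≡_ to _≡′_)

_!! : ℕ → ℕ
zero !!          = 1
suc zero !!      = 1
suc (suc m) !!   = suc (suc m) * (m !!)

-- pred!! m = (m - 1)!!, with the convention (-1)!! = 1
pred!! : ℕ → ℕ
pred!! zero    = 1
pred!! (suc m) = m !!

-- Deleting the node with the largest label n+1 from a q-blooming tree on n+2 nodes leaves a
-- q-blooming tree on n+1 nodes (that node is necessarily a leaf), and conversely each q-blooming
-- tree on n+1 nodes arises in this way from exactly 2n+q+1 trees: the new leaf may go into any
-- gap between consecutive children of a labelled node, ends included. A node with k children
-- has k+1 gaps, so there are (n+q) + (n+1) gaps in all. Hence the number of q-blooming trees on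
-- n+1 nodes is (q+1)(q+3)...(q+2n-1) = (2n+q-1)!!/(q-1)!!.

module Submission where

open import Defs
open import Data.Nat using (ℕ; _+_; _*_)
open import Data.Product using (Σ; _×_)
open import Relation.Binary.PropositionalEquality using (_≡_)

open import Data.Empty using (⊥-elim)
open import Data.List using (List; []; _∷_; _++_; map; length; concatMap; replicate; upTo; applyUpTo; [_]; _∷ʳ_)
open import Data.List.Properties using (length-++; length-map; length-upTo; map-upTo; applyUpTo-∷ʳ)
open import Data.List.Membership.Propositional using (_∈_; find)
open import Data.List.Membership.Propositional.Properties
  using (∈-map⁺; ∈-map⁻; ∈-++⁺ˡ; ∈-++⁺ʳ; ∈-++⁻; ∈-concatMap⁺; ∈-concatMap⁻)
open import Data.List.Relation.Binary.Disjoint.Propositional using (Disjoint)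
open import Data.List.Relation.Binary.Permutation.Propositional
  using (_↭_; ↭-refl; ↭-sym; ↭-trans; prep; swap; module PermutationReasoning)
import Data.List.Relation.Binary.Permutation.Propositional.Properties as ↭
open import Data.List.Relation.Unary.All using (All; []; _∷_)
import Data.List.Relation.Unary.All as All
import Data.List.Relation.Unary.All.Properties as All
open import Data.List.Relation.Unary.Any using (here; there)
import Data.List.Relation.Unary.Any as Any
open import Data.List.Relation.Unary.Unique.Propositional using (Unique; []; _∷_)
import Data.List.Relation.Unary.Unique.Propositional.Properties as Unique
open import Data.Maybe using (just; nothing)
open import Data.Nat using (zero; suc; _<_; _≤_; z≤n; s≤s)
open import Data.Nat.Properties using (<-irrefl; ≤⇒≯; +-identityʳ)
open import Data.Nat.Tactic.RingSolver using (solve-∀)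
open import Data.Product using (_,_; ∃)
import Data.Product as Product
open import Data.Sum using (inj₁; inj₂)
open import Data.Unit using (⊤; tt)
open import Function.Base using (id)
open import Function.Bundles using (mk⇔)
open import Function.Definitions using (Injective)
open import Relation.Nullary using (¬_)
open import Relation.Binary.PropositionalEquality using (_≢_; refl; sym; trans; cong; cong₂; module ≡-Reasoning)

Unique-map-++-map : {A B C : Set} {f : A → C} {g : B → C} {xs : List A} {ys : List B} →
                    Injective _≡_ _≡_ f → Injective _≡_ _≡_ g →
                    Unique xs → Unique ys → (∀ {x y} → x ∈ xs → y ∈ ys → f x ≢ g y) →
                    Unique (map f xs ++ map g ys)
Unique-map-++-map {f = f} {g} {xs} {ys} f-inj g-inj xs! ys! f≢g =
  Unique.++⁺ (Unique.map⁺ f-inj xs!) (Unique.map⁺ g-inj ys!) disjoint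
  where
  disjoint : Disjoint (map f xs) (map g ys)
  disjoint (fx∈ , gy∈) with _ , x∈ , refl ← ∈-map⁻ f fx∈ | _ , y∈ , eq ← ∈-map⁻ g gy∈ = f≢g x∈ y∈ eq

length-map-++-map : {A B C : Set} (f : A → C) (g : B → C) (xs : List A) (ys : List B) →
                    length (map f xs ++ map g ys) ≡ length xs + length ys
length-map-++-map f g xs ys = trans (length-++ (map f xs)) (cong₂ _+_ (length-map f xs) (length-map g ys))

Unique-concatMap : {A B : Set} {f : A → List B} {xs : List A} → Unique xs →
                   (∀ {x} → x ∈ xs → Unique (f x)) →
                   (∀ {x x' y} → x ∈ xs → x' ∈ xs → y ∈ f x → y ∈ f x' → x ≡ x') →
                   Unique (concatMap f xs)
Unique-concatMap {xs = []} _ _ _ = []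
Unique-concatMap {f = f} {x ∷ xs} (x∉ ∷ xs!) f! f-disjoint =
  Unique.++⁺ (f! (here refl))
             (Unique-concatMap xs! (λ x∈ → f! (there x∈)) (λ x∈ x'∈ → f-disjoint (there x∈) (there x'∈)))
             disjoint
  where
  disjoint : Disjoint (f x) (concatMap f xs)
  disjoint (y∈fx , y∈rest) with x' , x'∈ , y∈fx' ← find (∈-concatMap⁻ f y∈rest) =
    All.lookup x∉ x'∈ (f-disjoint (here refl) (there x'∈) y∈fx y∈fx')

length-concatMap-const : {A B : Set} (f : A → List B) (xs : List A) {k : ℕ} →
                         (∀ {x} → x ∈ xs → length (f x) ≡ k) → length (concatMap f xs) ≡ length xs * k
length-concatMap-const f [] _ = refl
length-concatMap-const f (x ∷ xs) len-f =
  trans (length-++ (f x))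
        (cong₂ _+_ (len-f (here refl)) (length-concatMap-const f xs (λ x∈ → len-f (there x∈))))

map-suc-upTo-suc : ∀ n → map suc (upTo (suc n)) ↭ suc n ∷ map suc (upTo n)
map-suc-upTo-suc n = begin
  map suc (upTo (suc n))      ≡⟨ map-upTo suc (suc n) ⟩
  applyUpTo suc (suc n)       ≡⟨ sym (applyUpTo-∷ʳ suc n) ⟩
  applyUpTo suc n ∷ʳ suc n    ≡⟨ cong (_∷ʳ suc n) (sym (map-upTo suc n)) ⟩
  map suc (upTo n) ∷ʳ suc n   ↭⟨ ↭.∷↭∷ʳ (suc n) (map suc (upTo n)) ⟨
  suc n ∷ map suc (upTo n)    ∎
  where open PermutationReasoning

All-map-suc-upTo : ∀ {P : ℕ → Set} n → (∀ {i} → i < n → P (suc i)) → All P (map suc (upTo n))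
All-map-suc-upTo n P-suc rewrite map-upTo suc n = All.applyUpTo⁺₁ suc n P-suc

leaf : ℕ → Tree
leaf m = node m []

-- All (_< m) (labelsL ts), by recursion on the forest so that it splits like ChildrenAbove.
Below : ℕ → List Tree → Set
Below m []               = ⊤
Below m (node a us ∷ ts) = a < m × Below m us × Below m ts

All<⇒Below : ∀ {m} ts → All (_< m) (labelsL ts) → Below m ts
All<⇒Below [] _ = tt
All<⇒Below (node a us ∷ ts) (a<m ∷ us++ts<m)
  with us<m , ts<m ← All.++⁻ (labelsL us) us++ts<m = a<m , All<⇒Below us us<m , All<⇒Below ts ts<m

data InsertLeaf (m : ℕ) : List Tree → List Tree → Set where
  front : ∀ {ts} → InsertLeaf m ts (leaf m ∷ ts)
  below : ∀ {a us us' ts} → InsertLeaf m us us' → InsertLeaf m (node a us ∷ ts) (node a us' ∷ ts)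
  later : ∀ {t ts ts'} → InsertLeaf m ts ts' → InsertLeaf m (t ∷ ts) (t ∷ ts')

labels-insertLeaf : ∀ {m ts ts'} → InsertLeaf m ts ts' → labelsL ts' ↭ m ∷ labelsL ts
labels-insertLeaf front = ↭-refl
labels-insertLeaf {m} (below {a} p) =
  ↭-trans (prep a (↭.++⁺ʳ _ (labels-insertLeaf p))) (swap a m ↭-refl)
labels-insertLeaf {m} (later {t} {ts} p) =
  ↭-trans (↭.++⁺ˡ (labels t) (labels-insertLeaf p)) (↭.shift m (labels t) (labelsL ts))

-- front would need ts ≡ leaf m ∷ ts, which the unifier rejects.
insertLeaf-irrefl : ∀ {m ts} → ¬ InsertLeaf m ts ts
insertLeaf-irrefl (below p) = insertLeaf-irrefl p
insertLeaf-irrefl (later p) = insertLeaf-irrefl p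

insertLeaf-¬Below : ∀ {m ts ts'} → InsertLeaf m ts ts' → ¬ Below m ts'
insertLeaf-¬Below front (m<m , _) = <-irrefl refl m<m
insertLeaf-¬Below (below p) (_ , us'<m , _) = insertLeaf-¬Below p us'<m
insertLeaf-¬Below (later {node _ _} p) (_ , _ , ts'<m) = insertLeaf-¬Below p ts'<m

ChildrenAbove-insertLeaf⁺ : ∀ {m a ts ts'} → a < m → Below m ts → ChildrenAbove a ts →
                            InsertLeaf m ts ts' → ChildrenAbove a ts'
ChildrenAbove-insertLeaf⁺ a<m _ above front = a<m , tt , above
ChildrenAbove-insertLeaf⁺ a<m (b<m , us<m , _) (a<b , above-us , above-ts) (below p) =
  a<b , ChildrenAbove-insertLeaf⁺ b<m us<m above-us p , above-ts
ChildrenAbove-insertLeaf⁺ {ts = node _ _ ∷ _} a<m (_ , _ , ts<m) (a<b , above-us , above-ts) (later p) =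
  a<b , above-us , ChildrenAbove-insertLeaf⁺ a<m ts<m above-ts p

ChildrenAbove-insertLeaf⁻ : ∀ {m a ts ts'} → InsertLeaf m ts ts' → ChildrenAbove a ts' → ChildrenAbove a ts
ChildrenAbove-insertLeaf⁻ front (_ , _ , above) = above
ChildrenAbove-insertLeaf⁻ (below p) (a<b , above-us , above-ts) =
  a<b , ChildrenAbove-insertLeaf⁻ p above-us , above-ts
ChildrenAbove-insertLeaf⁻ (later {node _ _} p) (a<b , above-us , above-ts) =
  a<b , above-us , ChildrenAbove-insertLeaf⁻ p above-ts

insertLeaf-injective : ∀ {m ts us vs} → Below m ts → Below m us →
                       InsertLeaf m ts vs → InsertLeaf m us vs → ts ≡ us
insertLeaf-injective _ _ front front = refl
insertLeaf-injective _ _ front (below ())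
insertLeaf-injective _ (m<m , _) front (later _) = ⊥-elim (<-irrefl refl m<m)
insertLeaf-injective _ _ (below ()) front
insertLeaf-injective (m<m , _) _ (later _) front = ⊥-elim (<-irrefl refl m<m)
insertLeaf-injective {ts = node a _ ∷ ts} (_ , us<m , _) (_ , us'<m , _) (below p) (below q) =
  cong (λ us → node a us ∷ ts) (insertLeaf-injective us<m us'<m p q)
insertLeaf-injective _ (_ , us'<m , _) (below p) (later _) = ⊥-elim (insertLeaf-¬Below p us'<m)
insertLeaf-injective (_ , us<m , _) _ (later _) (below q) = ⊥-elim (insertLeaf-¬Below q us<m)
insertLeaf-injective {ts = t@(node _ _) ∷ _} (_ , _ , ts<m) (_ , _ , ts'<m) (later p) (later q) =
  cong (t ∷_) (insertLeaf-injective ts<m ts'<m p q)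

maxLabel-childless : ∀ {b us} → ChildrenAbove b us → All (_≤ b) (labelsL us) → us ≡ []
maxLabel-childless {us = []} _ _ = refl
maxLabel-childless {us = node c _ ∷ _} (b<c , _) (c≤b ∷ _) = ⊥-elim (≤⇒≯ c≤b b<c)

removeMaxLeaf : ∀ {m a ts'} → ChildrenAbove a ts' → All (_≤ m) (labelsL ts') → m ∈ labelsL ts' →
                ∃ λ ts → InsertLeaf m ts ts'
removeMaxLeaf {ts' = node b us ∷ ts} (_ , above-us , _) (_ ∷ us++ts≤m) (here refl)
  with refl ← maxLabel-childless above-us (All.++⁻ˡ (labelsL us) us++ts≤m) = ts , front
removeMaxLeaf {ts' = node b us ∷ ts} (_ , above-us , above-ts) (_ ∷ us++ts≤m) (there m∈us++ts)
  with ∈-++⁻ (labelsL us) m∈us++ts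
... | inj₁ m∈us = Product.map (λ us₀ → node b us₀ ∷ ts) below
                    (removeMaxLeaf above-us (All.++⁻ˡ (labelsL us) us++ts≤m) m∈us)
... | inj₂ m∈ts = Product.map (node b us ∷_) later
                    (removeMaxLeaf above-ts (All.++⁻ʳ (labelsL us) us++ts≤m) m∈ts)

leafInsertions : ℕ → List Tree → List (List Tree)
leafInsertions m [] = [ leaf m ∷ [] ]
leafInsertions m (node a us ∷ ts) =
  (leaf m ∷ node a us ∷ ts) ∷
    (map (λ us' → node a us' ∷ ts) (leafInsertions m us) ++ map (node a us ∷_) (leafInsertions m ts))

∈-leafInsertions⁻ : ∀ {m ts ts'} → ts' ∈ leafInsertions m ts → InsertLeaf m ts ts'
∈-leafInsertions⁻ {ts = []} (here refl) = front
∈-leafInsertions⁻ {ts = node _ _ ∷ _} (here refl) = front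
∈-leafInsertions⁻ {m} {node a us ∷ ts} (there ∈rest)
  with ∈-++⁻ (map (λ us' → node a us' ∷ ts) (leafInsertions m us)) ∈rest
... | inj₁ ∈below with _ , us'∈ , refl ← ∈-map⁻ _ ∈below = below (∈-leafInsertions⁻ us'∈)
... | inj₂ ∈later with _ , ts'∈ , refl ← ∈-map⁻ _ ∈later = later (∈-leafInsertions⁻ ts'∈)

∈-leafInsertions⁺ : ∀ {m ts ts'} → InsertLeaf m ts ts' → ts' ∈ leafInsertions m ts
∈-leafInsertions⁺ {ts = []} front = here refl
∈-leafInsertions⁺ {ts = node _ _ ∷ _} front = here refl
∈-leafInsertions⁺ (below p) = there (∈-++⁺ˡ (∈-map⁺ _ (∈-leafInsertions⁺ p)))
∈-leafInsertions⁺ {m} (later {node a us} p) =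
  there (∈-++⁺ʳ (map _ (leafInsertions m us)) (∈-map⁺ _ (∈-leafInsertions⁺ p)))

length-leafInsertions : ∀ m ts → length (leafInsertions m ts) ≡ suc (2 * length (labelsL ts))
length-leafInsertions m [] = refl
length-leafInsertions m (node a us ∷ ts) = cong suc (begin
    length (map (λ us' → node a us' ∷ ts) (leafInsertions m us) ++
            map (node a us ∷_) (leafInsertions m ts))
  ≡⟨ length-map-++-map _ _ (leafInsertions m us) (leafInsertions m ts) ⟩
    length (leafInsertions m us) + length (leafInsertions m ts)
  ≡⟨ cong₂ _+_ (length-leafInsertions m us) (length-leafInsertions m ts) ⟩
    suc (2 * length (labelsL us)) + suc (2 * length (labelsL ts))
  ≡⟨ gaps-∷ (length (labelsL us)) (length (labelsL ts)) ⟩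
    2 * suc (length (labelsL us) + length (labelsL ts))
  ≡⟨ cong (λ k → 2 * suc k) (length-++ (labelsL us)) ⟨
    2 * length (labelsL (node a us ∷ ts))
  ∎)
  where
  open ≡-Reasoning
  gaps-∷ : ∀ k l → suc (2 * k) + suc (2 * l) ≡ 2 * suc (k + l)
  gaps-∷ = solve-∀

leafInsertions-unique : ∀ {m ts} → Below m ts → Unique (leafInsertions m ts)
leafInsertions-unique {ts = []} _ = [] ∷ []
-- The front insertion differs from the below ones in its tail (occurs check) and from the later
-- ones in its head (a < m).
leafInsertions-unique {m} {node a us ∷ ts} (a<m , us<m , ts<m) =
  All.++⁺ (All.map⁺ {xs = leafInsertions m us} {f = inside} (All.tabulate λ _ ()))
          (All.map⁺ {xs = leafInsertions m ts} {f = node a us ∷_}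
                    (All.tabulate λ { _ refl → <-irrefl refl a<m }))
  ∷ Unique-map-++-map (λ { refl → refl }) (λ { refl → refl })
      (leafInsertions-unique us<m) (leafInsertions-unique ts<m)
      (λ { us∈ _ refl → insertLeaf-irrefl (∈-leafInsertions⁻ us∈) })
  where
  inside : List Tree → List Tree
  inside us' = node a us' ∷ ts

data InsertLeafRaw (m : ℕ) : RawBlooming → RawBlooming → Set where
  front : ∀ {c} → InsertLeafRaw m c (just (leaf m) ∷ c)
  below : ∀ {a us us' c} → InsertLeaf m us us' →
          InsertLeafRaw m (just (node a us) ∷ c) (just (node a us') ∷ c)
  later : ∀ {x c c'} → InsertLeafRaw m c c' → InsertLeafRaw m (x ∷ c) (x ∷ c')

subtrees-insertLeafRaw : ∀ {m c c'} → InsertLeafRaw m c c' →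
                         InsertLeaf m (subtrees c) (subtrees c')
subtrees-insertLeafRaw front = front
subtrees-insertLeafRaw (below p) = below p
subtrees-insertLeafRaw (later {nothing} p) = subtrees-insertLeafRaw p
subtrees-insertLeafRaw (later {just _} p) = later (subtrees-insertLeafRaw p)

countBlooms-insertLeafRaw : ∀ {m c c'} → InsertLeafRaw m c c' → countBlooms c' ≡ countBlooms c
countBlooms-insertLeafRaw front = refl
countBlooms-insertLeafRaw (below _) = refl
countBlooms-insertLeafRaw (later {nothing} p) = cong suc (countBlooms-insertLeafRaw p)
countBlooms-insertLeafRaw (later {just _} p) = countBlooms-insertLeafRaw p

insertLeafRaw-lift : ∀ {m ts} c' → InsertLeaf m ts (subtrees c') → ∃ λ c → InsertLeafRaw m c c'
insertLeafRaw-lift (nothing ∷ c') p = Product.map (nothing ∷_) later (insertLeafRaw-lift c' p)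
insertLeafRaw-lift (just _ ∷ c') front = c' , front
insertLeafRaw-lift (just _ ∷ c') (below {a} {us} p) = just (node a us) ∷ c' , below p
insertLeafRaw-lift (just t ∷ c') (later p) = Product.map (just t ∷_) later (insertLeafRaw-lift c' p)

insertLeafRaw-injective : ∀ {m c d e} → Below m (subtrees c) → Below m (subtrees d) →
                          InsertLeafRaw m c e → InsertLeafRaw m d e → c ≡ d
insertLeafRaw-injective _ _ front front = refl
insertLeafRaw-injective _ _ front (below ())
insertLeafRaw-injective _ (m<m , _) front (later {just _} _) = ⊥-elim (<-irrefl refl m<m)
insertLeafRaw-injective _ _ (below ()) front
insertLeafRaw-injective (m<m , _) _ (later {just _} _) front = ⊥-elim (<-irrefl refl m<m)
insertLeafRaw-injective {c = just (node a _) ∷ c} (_ , us<m , _) (_ , us'<m , _) (below p) (below q) =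
  cong (λ us → just (node a us) ∷ c) (insertLeaf-injective us<m us'<m p q)
insertLeafRaw-injective _ (_ , us'<m , _) (below p) (later _) = ⊥-elim (insertLeaf-¬Below p us'<m)
insertLeafRaw-injective (_ , us<m , _) _ (later _) (below q) = ⊥-elim (insertLeaf-¬Below q us<m)
insertLeafRaw-injective c<m d<m (later {nothing} p) (later q) =
  cong (nothing ∷_) (insertLeafRaw-injective c<m d<m p q)
insertLeafRaw-injective {c = just t@(node _ _) ∷ _} (_ , _ , c<m) (_ , _ , d<m) (later p) (later q) =
  cong (just t ∷_) (insertLeafRaw-injective c<m d<m p q)

leafInsertionsRaw : ℕ → RawBlooming → List RawBlooming
leafInsertionsRaw m [] = [ just (leaf m) ∷ [] ]
leafInsertionsRaw m (nothing ∷ c) =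
  (just (leaf m) ∷ nothing ∷ c) ∷ map (nothing ∷_) (leafInsertionsRaw m c)
leafInsertionsRaw m (just (node a us) ∷ c) =
  (just (leaf m) ∷ just (node a us) ∷ c) ∷
    (map (λ us' → just (node a us') ∷ c) (leafInsertions m us) ++
     map (just (node a us) ∷_) (leafInsertionsRaw m c))

∈-leafInsertionsRaw⁻ : ∀ {m c c'} → c' ∈ leafInsertionsRaw m c → InsertLeafRaw m c c'
∈-leafInsertionsRaw⁻ {c = []} (here refl) = front
∈-leafInsertionsRaw⁻ {c = nothing ∷ _} (here refl) = front
∈-leafInsertionsRaw⁻ {c = just (node _ _) ∷ _} (here refl) = front
∈-leafInsertionsRaw⁻ {c = nothing ∷ _} (there ∈later) with _ , c'∈ , refl ← ∈-map⁻ _ ∈later =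
  later (∈-leafInsertionsRaw⁻ c'∈)
∈-leafInsertionsRaw⁻ {m} {just (node a us) ∷ c} (there ∈rest)
  with ∈-++⁻ (map (λ us' → just (node a us') ∷ c) (leafInsertions m us)) ∈rest
... | inj₁ ∈below with _ , us'∈ , refl ← ∈-map⁻ _ ∈below = below (∈-leafInsertions⁻ us'∈)
... | inj₂ ∈later with _ , c'∈ , refl ← ∈-map⁻ _ ∈later = later (∈-leafInsertionsRaw⁻ c'∈)

∈-leafInsertionsRaw⁺ : ∀ {m c c'} → InsertLeafRaw m c c' → c' ∈ leafInsertionsRaw m c
∈-leafInsertionsRaw⁺ {c = []} front = here refl
∈-leafInsertionsRaw⁺ {c = nothing ∷ _} front = here refl
∈-leafInsertionsRaw⁺ {c = just (node _ _) ∷ _} front = here refl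
∈-leafInsertionsRaw⁺ (below p) = there (∈-++⁺ˡ (∈-map⁺ _ (∈-leafInsertions⁺ p)))
∈-leafInsertionsRaw⁺ (later {nothing} p) = there (∈-map⁺ _ (∈-leafInsertionsRaw⁺ p))
∈-leafInsertionsRaw⁺ {m} (later {just (node a us)} p) =
  there (∈-++⁺ʳ (map _ (leafInsertions m us)) (∈-map⁺ _ (∈-leafInsertionsRaw⁺ p)))

length-leafInsertionsRaw : ∀ m c →
  length (leafInsertionsRaw m c) ≡ suc (countBlooms c + 2 * length (labelsL (subtrees c)))
length-leafInsertionsRaw m [] = refl
length-leafInsertionsRaw m (nothing ∷ c) =
  cong suc (trans (length-map _ (leafInsertionsRaw m c)) (length-leafInsertionsRaw m c))
length-leafInsertionsRaw m (just (node a us) ∷ c) = cong suc (begin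
    length (map (λ us' → just (node a us') ∷ c) (leafInsertions m us) ++
            map (just (node a us) ∷_) (leafInsertionsRaw m c))
  ≡⟨ length-map-++-map _ _ (leafInsertions m us) (leafInsertionsRaw m c) ⟩
    length (leafInsertions m us) + length (leafInsertionsRaw m c)
  ≡⟨ cong₂ _+_ (length-leafInsertions m us) (length-leafInsertionsRaw m c) ⟩
    suc (2 * length (labelsL us)) + suc (countBlooms c + 2 * length (labelsL (subtrees c)))
  ≡⟨ gaps-∷ (countBlooms c) (length (labelsL us)) (length (labelsL (subtrees c))) ⟩
    countBlooms c + 2 * suc (length (labelsL us) + length (labelsL (subtrees c)))
  ≡⟨ cong (λ k → countBlooms c + 2 * suc k) (length-++ (labelsL us)) ⟨
    countBlooms c + 2 * length (labelsL (subtrees (just (node a us) ∷ c)))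
  ∎)
  where
  open ≡-Reasoning
  gaps-∷ : ∀ q k l → suc (2 * k) + suc (q + 2 * l) ≡ q + 2 * suc (k + l)
  gaps-∷ = solve-∀

leafInsertionsRaw-unique : ∀ {m c} → Below m (subtrees c) → Unique (leafInsertionsRaw m c)
leafInsertionsRaw-unique {c = []} _ = [] ∷ []
leafInsertionsRaw-unique {m} {nothing ∷ c} c<m =
  All.map⁺ {xs = leafInsertionsRaw m c} {f = nothing ∷_} (All.tabulate λ _ ())
  ∷ Unique.map⁺ (λ { refl → refl }) (leafInsertionsRaw-unique c<m)
leafInsertionsRaw-unique {m} {just (node a us) ∷ c} (a<m , us<m , c<m) =
  All.++⁺ (All.map⁺ {xs = leafInsertions m us} {f = inside} (All.tabulate λ _ ()))
          (All.map⁺ {xs = leafInsertionsRaw m c} {f = just (node a us) ∷_}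
                    (All.tabulate λ { _ refl → <-irrefl refl a<m }))
  ∷ Unique-map-++-map (λ { refl → refl }) (λ { refl → refl })
      (leafInsertions-unique us<m) (leafInsertionsRaw-unique c<m)
      (λ { us∈ _ refl → insertLeaf-irrefl (∈-leafInsertions⁻ us∈) })
  where
  inside : List Tree → RawBlooming
  inside us' = just (node a us') ∷ c

noLabels⇒replicate-nothing : ∀ c → labelsL (subtrees c) ≡ [] → c ≡ replicate (countBlooms c) nothing
noLabels⇒replicate-nothing [] _ = refl
noLabels⇒replicate-nothing (nothing ∷ c) noLabels = cong (nothing ∷_) (noLabels⇒replicate-nothing c noLabels)
noLabels⇒replicate-nothing (just (node _ _) ∷ _) ()

IsBlooming-replicate : ∀ q → IsBlooming q 0 (replicate q nothing)
IsBlooming-replicate zero = refl , ↭-refl , tt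
IsBlooming-replicate (suc q) with blooms , perm , above ← IsBlooming-replicate q =
  cong suc blooms , perm , above

IsBlooming-zero : ∀ {q c} → IsBlooming q 0 c → c ≡ replicate q nothing
IsBlooming-zero {c = c} (blooms , perm , _) =
  trans (noLabels⇒replicate-nothing c (↭.↭-empty-inv perm)) (cong (λ k → replicate k nothing) blooms)

IsBlooming-Below : ∀ {q n} c → IsBlooming q n c → Below (suc n) (subtrees c)
IsBlooming-Below {n = n} c (_ , perm , _) =
  All<⇒Below (subtrees c) (↭.All-resp-↭ (↭-sym perm) (All-map-suc-upTo n s≤s))

IsBlooming-insertLeaf⁺ : ∀ {q n c c'} → IsBlooming q n c → InsertLeafRaw (suc n) c c' →
                         IsBlooming q (suc n) c'
IsBlooming-insertLeaf⁺ {n = n} {c} b@(blooms , perm , above) p =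
  trans (countBlooms-insertLeafRaw p) blooms ,
  ↭-trans (labels-insertLeaf p') (↭-trans (prep (suc n) perm) (↭-sym (map-suc-upTo-suc n))) ,
  ChildrenAbove-insertLeaf⁺ (s≤s z≤n) (IsBlooming-Below c b) above p'
  where p' = subtrees-insertLeafRaw p

IsBlooming-insertLeaf⁻ : ∀ {q n c'} → IsBlooming q (suc n) c' →
                         ∃ λ c → IsBlooming q n c × InsertLeafRaw (suc n) c c'
IsBlooming-insertLeaf⁻ {n = n} {c'} (blooms , perm , above)
  with _ , p ← removeMaxLeaf above (↭.All-resp-↭ (↭-sym perm) (All-map-suc-upTo (suc n) id))
                                   (↭.∈-resp-↭ (↭-sym (↭-trans perm (map-suc-upTo-suc n))) (here refl))
  with c , r ← insertLeafRaw-lift c' p =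
  let r' = subtrees-insertLeafRaw r in
  c , (trans (sym (countBlooms-insertLeafRaw r)) blooms ,
       ↭.drop-∷ (↭-trans (↭-sym (labels-insertLeaf r')) (↭-trans perm (map-suc-upTo-suc n))) ,
       ChildrenAbove-insertLeaf⁻ r' above) , r

bloomings : ℕ → ℕ → List RawBlooming
bloomings q zero = [ replicate q nothing ]
bloomings q (suc n) = concatMap (leafInsertionsRaw (suc n)) (bloomings q n)

∈-bloomings⁻ : ∀ q n {c} → c ∈ bloomings q n → IsBlooming q n c
∈-bloomings⁻ q zero (here refl) = IsBlooming-replicate q
∈-bloomings⁻ q (suc n) c∈
  with _ , c₀∈ , c∈ins ← find (∈-concatMap⁻ (leafInsertionsRaw (suc n)) c∈) =
  IsBlooming-insertLeaf⁺ (∈-bloomings⁻ q n c₀∈) (∈-leafInsertionsRaw⁻ c∈ins)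

∈-bloomings⁺ : ∀ q n {c} → IsBlooming q n c → c ∈ bloomings q n
∈-bloomings⁺ q zero b = here (IsBlooming-zero b)
∈-bloomings⁺ q (suc n) b with _ , b₀ , p ← IsBlooming-insertLeaf⁻ b =
  ∈-concatMap⁺ (leafInsertionsRaw (suc n))
               (Any.map (λ { refl → ∈-leafInsertionsRaw⁺ p }) (∈-bloomings⁺ q n b₀))

bloomings-unique : ∀ q n → Unique (bloomings q n)
bloomings-unique q zero = [] ∷ []
bloomings-unique q (suc n) =
  Unique-concatMap (bloomings-unique q n)
    (λ c∈ → leafInsertionsRaw-unique (∈⇒Below c∈))
    (λ c∈ d∈ e∈ e∈′ → insertLeafRaw-injective (∈⇒Below c∈) (∈⇒Below d∈)
                        (∈-leafInsertionsRaw⁻ e∈) (∈-leafInsertionsRaw⁻ e∈′))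
  where
  ∈⇒Below : ∀ {c} → c ∈ bloomings q n → Below (suc n) (subtrees c)
  ∈⇒Below {c} c∈ = IsBlooming-Below c (∈-bloomings⁻ q n c∈)

length-bloomings-suc : ∀ q n →
                       length (bloomings q (suc n)) ≡ length (bloomings q n) * suc (q + 2 * n)
length-bloomings-suc q n = length-concatMap-const (leafInsertionsRaw (suc n)) (bloomings q n) gaps
  where
  gaps : ∀ {c} → c ∈ bloomings q n → length (leafInsertionsRaw (suc n) c) ≡ suc (q + 2 * n)
  gaps {c} c∈ with blooms , perm , _ ← ∈-bloomings⁻ q n c∈ =
    trans (length-leafInsertionsRaw (suc n) c)
          (cong₂ (λ k l → suc (k + 2 * l)) blooms
                 (trans (↭.↭-length perm) (trans (length-map suc (upTo n)) (length-upTo n))))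

pred!!-suc-suc : ∀ k → pred!! (suc (suc k)) ≡ suc k * pred!! k
pred!!-suc-suc zero = refl
pred!!-suc-suc (suc k) = refl

length-bloomings : ∀ q n → length (bloomings q n) * pred!! q ≡ pred!! (2 * n + q)
length-bloomings q zero = +-identityʳ (pred!! q)
length-bloomings q (suc n) = begin
    length (bloomings q (suc n)) * pred!! q
  ≡⟨ cong (_* pred!! q) (length-bloomings-suc q n) ⟩
    length (bloomings q n) * suc (q + 2 * n) * pred!! q
  ≡⟨ regroup (length (bloomings q n)) (pred!! q) q n ⟩
    suc (2 * n + q) * (length (bloomings q n) * pred!! q)
  ≡⟨ cong (suc (2 * n + q) *_) (length-bloomings q n) ⟩
    suc (2 * n + q) * pred!! (2 * n + q)
  ≡⟨ pred!!-suc-suc (2 * n + q) ⟨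
    pred!! (suc (suc (2 * n + q)))
  ≡⟨ cong pred!! (two-suc n q) ⟩
    pred!! (2 * suc n + q)
  ∎
  where
  open ≡-Reasoning
  regroup : ∀ x p q n → x * suc (q + 2 * n) * p ≡ suc (2 * n + q) * (x * p)
  regroup = solve-∀
  two-suc : ∀ n q → suc (suc (2 * n + q)) ≡ 2 * suc n + q
  two-suc = solve-∀

lemma5p10 : (q n : ℕ) → Σ ℕ (λ N → HasCardinality (IsBlooming q n) N × (N * pred!! q ≡ pred!! (2 * n + q)))
lemma5p10 q n =
  length (bloomings q n) ,
  (bloomings q n , bloomings-unique q n , (λ c → mk⇔ (∈-bloomings⁺ q n) (∈-bloomings⁻ q n)) , refl) ,
  length-bloomings q n
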